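{- Let $G$ be a connected graph and let $D$ be the digraph obtained from $G$ by replacing each edge $\{u,v\}$ of $G$ with the pair of arcs $(u,v)$ and $(v,u)$. Then $\mathrm{uin}(G)=\mathrm{wdin}(D)$.
   Context: An intersection representation of a graph $G=(V,E)$ is a pair $(U,\varphi)$ with $U$ a finite set and $\varphi(v)\subseteq U$ for each $v\in V$ such that for distinct $u,v$: $\{u,v\}\in E$ iff $\varphi(u)\cap\varphi(v)\neq\emptyset$. $\mathrm{uin}(G)$ is the minimum $|U|$ over all intersection representations $(U,\varphi)$ of $G$ in which all sets $\varphi(v)$ have the same cardinality. A weak directed intersection representation of a digraph $D=(V,A)$ is a pair $(U,\varphi)$ with $\varphi(v)\subseteq U$ such that for any two distinct $u,v\in V$: $(u,v)\in A$ iff $\varphi(u)\cap\varphi(v)\neq\emptyset$ and $|\varphi(u)|\le|\varphi(v)|$; $\mathrm{wdin}(D)$ is the minimum $|U|$ over all such representations. -}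

module Defs where

open import Data.Nat using (ℕ; _≤_)
open import Data.Fin using (Fin)
open import Data.Fin.Subset using (Subset; _∈_; ∣_∣)
open import Data.Product using (Σ; ∃; _×_)
open import Relation.Binary.PropositionalEquality using (_≡_)
open import Relation.Nullary using (¬_)
open import Function.Bundles using (_⇔_)

record Graph (n : ℕ) : Set₁ where
  field
    Adj    : Fin n → Fin n → Set
    sym    : ∀ {u v} → Adj u v → Adj v u
    irrefl : ∀ {u} → ¬ Adj u u

-- A digraph on vertex set Fin n: an arc relation (loops irrelevant).
record Digraph (n : ℕ) : Set₁ where
  field
    Arc : Fin n → Fin n → Set

open Graph
open Digraph

data Walk {n : ℕ} (G : Graph n) : Fin n → Fin n → Set where
  here : ∀ {u} → Walk G u u
  step : ∀ {u v w} → Adj G u v → Walk G v w → Walk G u w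

Connected : ∀ {n} → Graph n → Set
Connected G = ∀ u v → Walk G u v

-- The digraph obtained by replacing each edge {u,v} by arcs (u,v) and (v,u).
bidirect : ∀ {n} → Graph n → Digraph n
bidirect G = record { Arc = Adj G }

Meets : ∀ {m} → Subset m → Subset m → Set
Meets A B = ∃ λ x → (x ∈ A) × (x ∈ B)

IsIntRep : ∀ {n} → Graph n → (m : ℕ) → (Fin n → Subset m) → Set
IsIntRep G m φ = ∀ u v → ¬ u ≡ v → (Adj G u v ⇔ Meets (φ u) (φ v))

IsUniform : ∀ {n m} → (Fin n → Subset m) → Set
IsUniform φ = ∀ u v → ∣ φ u ∣ ≡ ∣ φ v ∣

HasUniRep : ∀ {n} → Graph n → ℕ → Set
HasUniRep G m = Σ (Fin _ → Subset m) λ φ → IsIntRep G m φ × IsUniform φ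

IsUin : ∀ {n} → Graph n → ℕ → Set
IsUin G k = HasUniRep G k × (∀ m → HasUniRep G m → k ≤ m)

IsWeakDirRep : ∀ {n} → Digraph n → (m : ℕ) → (Fin n → Subset m) → Set
IsWeakDirRep D m φ =
  ∀ u v → ¬ u ≡ v → (Arc D u v ⇔ (Meets (φ u) (φ v) × ∣ φ u ∣ ≤ ∣ φ v ∣))

HasWDRep : ∀ {n} → Digraph n → ℕ → Set
HasWDRep D m = Σ (Fin _ → Subset m) λ φ → IsWeakDirRep D m φ

IsWdin : ∀ {n} → Digraph n → ℕ → Set
IsWdin D k = HasWDRep D k × (∀ m → HasWDRep D m → k ≤ m)

-- A uniform intersection representation of G is a weak directed one of its
-- bidirection, since the cardinality condition always holds.  Conversely, in a
-- weak directed representation of the bidirection every edge yields arcs both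
-- ways, forcing equal cardinalities at its ends; by connectivity all sets then
-- have the same size, and two meeting sets give an arc in at least one
-- direction, i.e. an edge.  Both notions are realisable on exactly the same
-- universe sizes, so their minima agree.
{-# OPTIONS --safe #-}
module Submission where

open import Defs
open import Data.Nat using (ℕ; _≤_)
open import Data.Nat.Properties using (≤-antisym; ≤-total; ≤-reflexive)
open import Data.Fin using (Fin)
open import Data.Fin.Subset using (Subset; ∣_∣)
open import Data.Product using (_,_; proj₁; proj₂; _×_)
open import Data.Sum using (inj₁; inj₂)
open import Function.Bundles using (_⇔_; mk⇔; Equivalence)
open import Relation.Binary.PropositionalEquality using (_≡_; refl; trans; ≢-sym)
open import Relation.Nullary using (¬_)
open Graph using (Adj; irrefl) renaming (sym to Adj-sym)
open Equivalence using (to; from)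

Meets-sym : ∀ {m} {A B : Subset m} → Meets A B → Meets B A
Meets-sym (x , x∈A , x∈B) = x , x∈B , x∈A

Adj⇒≢ : ∀ {n} (G : Graph n) {u v} → Adj G u v → ¬ u ≡ v
Adj⇒≢ G uv refl = irrefl G uv

Walk-preserves : ∀ {n} {A : Set} (G : Graph n) (f : Fin n → A) →
  (∀ {u v} → Adj G u v → f u ≡ f v) → ∀ {u v} → Walk G u v → f u ≡ f v
Walk-preserves G f edge here         = refl
Walk-preserves G f edge (step uv vw) = trans (edge uv) (Walk-preserves G f edge vw)

Connected⇒constant : ∀ {n} {A : Set} (G : Graph n) → Connected G → (f : Fin n → A) →
  (∀ {u v} → Adj G u v → f u ≡ f v) → ∀ u v → f u ≡ f v
Connected⇒constant G conn f edge u v = Walk-preserves G f edge (conn u v)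

module _ {n m} (G : Graph n) {φ : Fin n → Subset m} where

  uniformIntRep⇒weakDirRep : IsIntRep G m φ → IsUniform φ → IsWeakDirRep (bidirect G) m φ
  uniformIntRep⇒weakDirRep rep uni u v u≢v = mk⇔
    (λ uv → to (rep u v u≢v) uv , ≤-reflexive (uni u v))
    (λ (meet , _) → from (rep u v u≢v) meet)

  module _ (rep : IsWeakDirRep (bidirect G) m φ) where

    weakDirRep⇒intRep : IsIntRep G m φ
    weakDirRep⇒intRep u v u≢v = mk⇔ (λ uv → proj₁ (to (rep u v u≢v) uv)) meets⇒Adj
      where
      meets⇒Adj : Meets (φ u) (φ v) → Adj G u v
      meets⇒Adj meet with ≤-total ∣ φ u ∣ ∣ φ v ∣
      ... | inj₁ u≤v = from (rep u v u≢v) (meet , u≤v)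
      ... | inj₂ v≤u = Adj-sym G (from (rep v u (≢-sym u≢v)) (Meets-sym meet , v≤u))

    weakDirRep-Adj⇒∣≡∣ : ∀ {u v} → Adj G u v → ∣ φ u ∣ ≡ ∣ φ v ∣
    weakDirRep-Adj⇒∣≡∣ {u} {v} uv = ≤-antisym
      (proj₂ (to (rep u v (Adj⇒≢ G uv)) uv))
      (proj₂ (to (rep v u (Adj⇒≢ G vu)) vu))
      where vu = Adj-sym G uv

module _ {n} (G : Graph n) where

  HasUniRep⇒HasWDRep : ∀ {m} → HasUniRep G m → HasWDRep (bidirect G) m
  HasUniRep⇒HasWDRep (φ , rep , uni) = φ , uniformIntRep⇒weakDirRep G rep uni

  HasWDRep⇒HasUniRep : Connected G → ∀ {m} → HasWDRep (bidirect G) m → HasUniRep G m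
  HasWDRep⇒HasUniRep conn (φ , rep) =
    φ , weakDirRep⇒intRep G rep ,
    Connected⇒constant G conn (λ u → ∣ φ u ∣) (weakDirRep-Adj⇒∣≡∣ G rep)

least-cong : {P Q : ℕ → Set} → (∀ m → P m ⇔ Q m) → ∀ k →
  (P k × (∀ m → P m → k ≤ m)) ⇔ (Q k × (∀ m → Q m → k ≤ m))
least-cong P⇔Q k = mk⇔
  (λ (pk , least) → to (P⇔Q k) pk , λ m qm → least m (from (P⇔Q m) qm))
  (λ (qk , least) → from (P⇔Q k) qk , λ m pm → least m (to (P⇔Q m) pm))

proposition3 : ∀ {n} (G : Graph n) → Connected G →
    ∀ (k : ℕ) → (IsUin G k ⇔ IsWdin (bidirect G) k)
proposition3 G conn = least-cong λ m →
  mk⇔ (HasUniRep⇒HasWDRep G) (HasWDRep⇒HasUniRep G conn)
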